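{- Let $A\subseteq\omega$ be oracle effectively densely computable. Then $A$ is intrinsically generically computable.
   Context: For $S\subseteq\omega$ and $n\geq 1$, $\rho_n(S)=|S\cap\{0,\dots,n-1\}|/n$, $\overline{\rho}(S)=\limsup_n\rho_n(S)$, $\underline{\rho}(S)=\liminf_n\rho_n(S)$. A set $S$ is intrinsically small if $\overline{\rho}(\pi(S))=0$ for every computable permutation $\pi$ of $\omega$. An effective dense description of $B\subseteq\omega$ is a total function $\psi:\omega\to\{0,1,\square\}$ with $\underline{\rho}(\psi^{ -1}(\{0,1\}))=1$ such that $\psi(n)\in\{0,1\}$ implies $\psi(n)=B(n)$. $A$ is oracle effectively densely computable if there is a Turing functional $\Phi$ such that for every $e$ for which the $e$-th partial computable function $\varphi_e$ is a permutation of $\omega$, $\Phi^{X}$ is an effective dense description of $\varphi_e(A)$, where $X=\mathrm{graph}(\varphi_e)$ (viewed as a subset of $\omega$ via a computable pairing function). $A$ is intrinsically generically computable if there is a partial computable $\varphi$ such that $\varphi(n)\downarrow$ implies $\varphi(n)=A(n)$ and $\{n:\varphi(n)\uparrow\}$ is intrinsically small. -}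

module Defs where

open import Data.Nat using (ℕ; zero; suc; _+_; _*_; _≤_; _<_)
open import Data.Fin using (Fin)
open import Data.Vec using (Vec; []; _∷_; lookup; tabulate)
open import Data.Bool using (Bool; true; false)
open import Data.Product using (Σ; ∃; _×_; _,_)
open import Data.Empty using (⊥)
open import Data.Sum using (_⊎_)
open import Relation.Nullary using (¬_)
open import Relation.Binary.PropositionalEquality using (_≡_)

data Code : ℕ → Set where
  zeroC : ∀ {n} → Code n
  sucC  : Code 1
  proj  : ∀ {n} → Fin n → Code n
  comp  : ∀ {m n} → Code m → (Fin m → Code n) → Code n
  prec  : ∀ {n} → Code n → Code (suc (suc n)) → Code (suc n)
          -- f(0,x) = g(x), f(y+1,x) = h(y, f(y,x), x)
  mu    : ∀ {n} → Code (suc n) → Code n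
  orc   : Code 1

data Eval (X : ℕ → Set) : ∀ {n} → Code n → Vec ℕ n → ℕ → Set where
  e-zero : ∀ {n} {xs : Vec ℕ n} → Eval X zeroC xs 0
  e-suc  : ∀ {x} → Eval X sucC (x ∷ []) (suc x)
  e-proj : ∀ {n} {i : Fin n} {xs} → Eval X (proj i) xs (lookup xs i)
  e-comp : ∀ {m n} {f : Code m} {gs : Fin m → Code n} {xs v}
           (ys : Fin m → ℕ) →
           (∀ i → Eval X (gs i) xs (ys i)) →
           Eval X f (tabulate ys) v →
           Eval X (comp f gs) xs v
  e-prec0 : ∀ {n} {g : Code n} {h xs v} →
            Eval X g xs v → Eval X (prec g h) (0 ∷ xs) v
  e-precS : ∀ {n} {g : Code n} {h y xs w v} →
            Eval X (prec g h) (y ∷ xs) w →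
            Eval X h (y ∷ w ∷ xs) v →
            Eval X (prec g h) (suc y ∷ xs) v
  e-mu   : ∀ {n} {f : Code (suc n)} {xs y} →
           Eval X f (y ∷ xs) 0 →
           (∀ z → z < y → Σ ℕ λ w → Eval X f (z ∷ xs) (suc w)) →
           Eval X (mu f) xs y
  e-orc-yes : ∀ {x} → X x → Eval X orc (x ∷ []) 1
  e-orc-no  : ∀ {x} → ¬ X x → Eval X orc (x ∷ []) 0

-- The empty oracle: plain (unrelativised) computations.
∅ : ℕ → Set
∅ _ = ⊥

_⟨_⟩[_]≃_ : Code 1 → (ℕ → Set) → ℕ → ℕ → Set
c ⟨ X ⟩[ n ]≃ m = Eval X c (n ∷ []) m

_[_]≃_ : Code 1 → ℕ → ℕ → Set
c [ n ]≃ m = c ⟨ ∅ ⟩[ n ]≃ m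

tri : ℕ → ℕ
tri zero    = zero
tri (suc k) = suc k + tri k

⟪_,_⟫ : ℕ → ℕ → ℕ
⟪ n , m ⟫ = tri (n + m) + m

IsPermutation : Code 1 → Set
IsPermutation c =
  (∀ n → ∃ λ m → c [ n ]≃ m)
  × (∀ n n' m → c [ n ]≃ m → c [ n' ]≃ m → n ≡ n')
  × (∀ m → ∃ λ n → c [ n ]≃ m)

image : Code 1 → (ℕ → Set) → (ℕ → Set)
image c S y = ∃ λ x → S x × c [ x ]≃ y

graph : Code 1 → (ℕ → Set)
graph c k = ∃ λ n → ∃ λ m → k ≡ ⟪ n , m ⟫ × c [ n ]≃ m

AtLeast : (ℕ → Set) → ℕ → ℕ → Set
AtLeast S N k =
  Σ (Fin k → ℕ) λ f →
    (∀ i j → f i ≡ f j → i ≡ j) × (∀ i → f i < N × S (f i))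

-- upper density 0:  ∀ m ∃ N₀ ∀ N ≥ N₀, ρ_N(S) ≤ 1/(m+1)
UpperDensityZero : (ℕ → Set) → Set
UpperDensityZero S =
  ∀ m → ∃ λ N₀ → ∀ N → N₀ ≤ N → ∀ k → AtLeast S N k → k * suc m ≤ N

-- lower density 1:  ∀ m ∃ N₀ ∀ N ≥ N₀, ρ_N(S) ≥ m/(m+1)
LowerDensityOne : (ℕ → Set) → Set
LowerDensityOne S =
  ∀ m → ∃ λ N₀ → ∀ N → N₀ ≤ N → ∃ λ k → AtLeast S N k × m * N ≤ k * suc m

bit : Bool → ℕ
bit false = 0
bit true  = 1

IntrinsicallySmall : (ℕ → Set) → Set
IntrinsicallySmall S = ∀ π → IsPermutation π → UpperDensityZero (image π S)

-- Effective dense description of B ⊆ ω, given relationally by the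
-- (total) computation Φ^X; outputs 0,1 are bits, 2 encodes □.
EffDenseDescription : Code 1 → (ℕ → Set) → (ℕ → Set) → Set
EffDenseDescription Φ X B =
  (∀ n → ∃ λ v → Φ ⟨ X ⟩[ n ]≃ v × v ≤ 2)
  × (∀ n → Φ ⟨ X ⟩[ n ]≃ 1 → B n)
  × (∀ n → Φ ⟨ X ⟩[ n ]≃ 0 → ¬ B n)
  × LowerDensityOne (λ n → Φ ⟨ X ⟩[ n ]≃ 0 ⊎ Φ ⟨ X ⟩[ n ]≃ 1)

OracleEffDenselyComputable : (ℕ → Bool) → Set
OracleEffDenselyComputable A =
  ∃ λ (Φ : Code 1) → ∀ e → IsPermutation e →
    EffDenseDescription Φ (graph e) (image e (λ n → A n ≡ true))

IntrinsicallyGenericallyComputable : (ℕ → Bool) → Set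
IntrinsicallyGenericallyComputable A =
  ∃ λ (φ : Code 1) →
    (∀ n v → φ [ n ]≃ v → v ≡ bit (A n))
    × IntrinsicallySmall (λ n → ¬ ∃ λ v → φ [ n ]≃ v)

-- Let p_q be the q-th finite permutation (a coded product of transpositions) and let H(q, n)
-- be Φ run with the graph of p_q as oracle at input p_q(n); H is computable, uniformly in q.
-- Since Φ describes p_q(A), H(q, n) ∈ {0, 1} forces H(q, n) = A(n), so φ(n) = H(q, n) for the
-- least such q is correct where defined. For a computable permutation π, a computation of
-- Φ^{graph π}(π x) ∈ {0, 1} uses only finitely much of graph π, which some p_q copies; so φ(x)
-- converges. Hence π maps the divergence set of φ into the set where Φ^{graph π} answers □,
-- which has density 0.

module Submission where

open import Defs
open import Data.Nat
  using (ℕ; zero; suc; _+_; _*_; _∸_; _⊔_; _≤_; _<_; z≤n; s≤s; s≤s⁻¹; pred; ∣_-_∣; _≟_; _<?_; ≢-nonZero)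
open import Data.Nat.Properties
open import Data.Fin using (Fin; zero; suc; fromℕ<; toℕ; splitAt; join)
open import Data.Fin.Properties using (toℕ-fromℕ<; join-splitAt; injective⇒≤)
open import Data.Vec using (Vec; []; _∷_; lookup; tabulate)
open import Data.Vec.Properties using (tabulate∘lookup; tabulate-cong)
open import Data.Vec.Relation.Binary.Pointwise.Inductive as Pointwise using (Pointwise; []; _∷_)
open import Data.Bool using (Bool; true; false)
open import Data.Product using (∃; _×_; _,_; proj₁; proj₂)
open import Data.Empty using (⊥; ⊥-elim)
open import Data.Sum using (_⊎_; inj₁; inj₂; [_,_]′)
open import Relation.Nullary using (¬_; yes; no)
open import Relation.Unary using (Decidable)
open import Relation.Binary using (tri<; tri≈; tri>)
open import Relation.Binary.PropositionalEquality
open import Function using (_∘_)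

Ev : ∀ {n} → Code n → Vec ℕ n → ℕ → Set
Ev = Eval ∅

eval-deterministic : ∀ {X n} {c : Code n} {xs v w} → Eval X c xs v → Eval X c xs w → v ≡ w
eval-deterministic e-zero e-zero = refl
eval-deterministic e-suc e-suc = refl
eval-deterministic e-proj e-proj = refl
eval-deterministic {X} (e-comp {f = f} ys ds d) (e-comp ys′ ds′ d′) =
  eval-deterministic d (subst (λ zs → Eval X f zs _)
    (sym (tabulate-cong (λ i → eval-deterministic (ds i) (ds′ i)))) d′)
eval-deterministic (e-prec0 d) (e-prec0 d′) = eval-deterministic d d′
eval-deterministic (e-precS d e) (e-precS d′ e′) with eval-deterministic d d′
... | refl = eval-deterministic e e′
eval-deterministic (e-mu {y = y} d below) (e-mu {y = y′} d′ below′) with <-cmp y y′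
... | tri< y<y′ _ _ with eval-deterministic d (proj₂ (below′ y y<y′))
...   | ()
eval-deterministic (e-mu d below) (e-mu d′ below′) | tri≈ _ refl _ = refl
eval-deterministic (e-mu {y = y} d below) (e-mu {y = y′} d′ below′) | tri> _ _ y′<y
  with eval-deterministic d′ (proj₂ (below y′ y′<y))
... | ()
eval-deterministic (e-orc-yes p) (e-orc-yes q) = refl
eval-deterministic (e-orc-yes p) (e-orc-no q) = ⊥-elim (q p)
eval-deterministic (e-orc-no p) (e-orc-yes q) = ⊥-elim (p q)
eval-deterministic (e-orc-no p) (e-orc-no q) = refl

infix 10 _∘ᶜ_

_∘ᶜ_ : ∀ {m n} → Code m → Vec (Code n) m → Code n
f ∘ᶜ gs = comp f (lookup gs)

EvalAll : (ℕ → Set) → ∀ {m n} → Vec (Code n) m → Vec ℕ n → Vec ℕ m → Set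
EvalAll X gs xs ys = Pointwise (λ g y → Eval X g xs y) gs ys

eval-∘ : ∀ {X m n} {f : Code m} {gs : Vec (Code n) m} {xs ys v} →
         EvalAll X gs xs ys → Eval X f ys v → Eval X (f ∘ᶜ gs) xs v
eval-∘ {X} {f = f} {ys = ys} {v} ds d =
  e-comp (lookup ys) (Pointwise.lookup ds) (subst (λ zs → Eval X f zs v) (sym (tabulate∘lookup ys)) d)

eval-∘⁻¹ : ∀ {X m n} {f : Code m} {gs : Vec (Code n) m} {xs v} →
           Eval X (f ∘ᶜ gs) xs v → ∃ λ ys → EvalAll X gs xs ys × Eval X f ys v
eval-∘⁻¹ {X} {gs = gs} {xs} (e-comp ys ds d) =
  tabulate ys ,
  subst (λ hs → EvalAll X hs xs (tabulate ys)) (tabulate∘lookup gs) (Pointwise.tabulate⁺ ds) ,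
  d

evalAll-deterministic : ∀ {X m n} {gs : Vec (Code n) m} {xs ys zs} →
                        EvalAll X gs xs ys → EvalAll X gs xs zs → ys ≡ zs
evalAll-deterministic [] [] = refl
evalAll-deterministic (d ∷ ds) (e ∷ es) =
  cong₂ _∷_ (eval-deterministic d e) (evalAll-deterministic ds es)

-- Arithmetic codes

arg₀ : ∀ {n} → Code (suc n)
arg₀ = proj zero

arg₁ : ∀ {n} → Code (suc (suc n))
arg₁ = proj (suc zero)

arg₂ : ∀ {n} → Code (suc (suc (suc n)))
arg₂ = proj (suc (suc zero))

constᶜ : ∀ {n} → ℕ → Code n
constᶜ zero = zeroC
constᶜ (suc k) = sucC ∘ᶜ (constᶜ k ∷ [])

constᶜ-eval : ∀ {X n} k {xs : Vec ℕ n} → Eval X (constᶜ k) xs k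
constᶜ-eval zero = e-zero
constᶜ-eval (suc k) = eval-∘ (constᶜ-eval k ∷ []) e-suc

sucᶜ : ∀ {n} → Code n → Code n
sucᶜ g = sucC ∘ᶜ (g ∷ [])

sucᶜ-eval : ∀ {X n} {g : Code n} {xs v} → Eval X g xs v → Eval X (sucᶜ g) xs (suc v)
sucᶜ-eval d = eval-∘ (d ∷ []) e-suc

infixr 9 _∙ᶜ_

_∙ᶜ_ : ∀ {n} → Code 1 → Code n → Code n
g ∙ᶜ f = g ∘ᶜ (f ∷ [])

∙ᶜ-eval : ∀ {X n} {g : Code 1} {f : Code n} {xs a b} →
          Eval X f xs a → Eval X g (a ∷ []) b → Eval X (g ∙ᶜ f) xs b
∙ᶜ-eval d e = eval-∘ (d ∷ []) e

addᶜ : Code 2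
addᶜ = prec arg₀ (sucᶜ arg₁)

addᶜ-eval : ∀ x y → Ev addᶜ (x ∷ y ∷ []) (x + y)
addᶜ-eval zero y = e-prec0 e-proj
addᶜ-eval (suc x) y = e-precS (addᶜ-eval x y) (sucᶜ-eval e-proj)

infixl 6 _+ᶜ_ _∸ᶜ_

_+ᶜ_ : ∀ {n} → Code n → Code n → Code n
f +ᶜ g = addᶜ ∘ᶜ (f ∷ g ∷ [])

+ᶜ-eval : ∀ {n} {f g : Code n} {xs a b} → Ev f xs a → Ev g xs b → Ev (f +ᶜ g) xs (a + b)
+ᶜ-eval {a = a} {b} d e = eval-∘ (d ∷ e ∷ []) (addᶜ-eval a b)

predᶜ : Code 1
predᶜ = prec zeroC arg₀

predᶜ-eval : ∀ k → Ev predᶜ (k ∷ []) (pred k)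
predᶜ-eval zero = e-prec0 e-zero
predᶜ-eval (suc k) = e-precS (predᶜ-eval k) e-proj

monusᶜ : Code 2
monusᶜ = prec arg₀ (predᶜ ∙ᶜ arg₁)

monusᶜ-eval : ∀ y x → Ev monusᶜ (y ∷ x ∷ []) (x ∸ y)
monusᶜ-eval zero x = e-prec0 e-proj
monusᶜ-eval (suc y) x =
  subst (Ev monusᶜ (suc y ∷ x ∷ [])) (pred[m∸n]≡m∸[1+n] x y)
    (e-precS (monusᶜ-eval y x) (∙ᶜ-eval e-proj (predᶜ-eval (x ∸ y))))

_∸ᶜ_ : ∀ {n} → Code n → Code n → Code n
f ∸ᶜ g = monusᶜ ∘ᶜ (g ∷ f ∷ [])

∸ᶜ-eval : ∀ {n} {f g : Code n} {xs a b} → Ev f xs a → Ev g xs b → Ev (f ∸ᶜ g) xs (a ∸ b)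
∸ᶜ-eval {a = a} {b} d e = eval-∘ (e ∷ d ∷ []) (monusᶜ-eval b a)

∸+∸≡∣-∣ : ∀ a b → (a ∸ b) + (b ∸ a) ≡ ∣ a - b ∣
∸+∸≡∣-∣ zero zero = refl
∸+∸≡∣-∣ zero (suc b) = refl
∸+∸≡∣-∣ (suc a) zero = +-identityʳ (suc a)
∸+∸≡∣-∣ (suc a) (suc b) = ∸+∸≡∣-∣ a b

distᶜ : ∀ {n} → Code n → Code n → Code n
distᶜ f g = (f ∸ᶜ g) +ᶜ (g ∸ᶜ f)

distᶜ-eval : ∀ {n} {f g : Code n} {xs a b} →
             Ev f xs a → Ev g xs b → Ev (distᶜ f g) xs ∣ a - b ∣
distᶜ-eval {a = a} {b} d e = subst (Ev _ _) (∸+∸≡∣-∣ a b) (+ᶜ-eval (∸ᶜ-eval d e) (∸ᶜ-eval e d))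

ifZero : ℕ → ℕ → ℕ → ℕ
ifZero zero x y = x
ifZero (suc _) x y = y

ifZeroᶜ : Code 3
ifZeroᶜ = prec arg₀ (proj (suc (suc (suc zero))))

ifZeroᶜ-eval : ∀ t x y → Ev ifZeroᶜ (t ∷ x ∷ y ∷ []) (ifZero t x y)
ifZeroᶜ-eval zero x y = e-prec0 e-proj
ifZeroᶜ-eval (suc t) x y = e-precS (ifZeroᶜ-eval t x y) e-proj

ifEq : ℕ → ℕ → ℕ → ℕ → ℕ
ifEq a b x y = ifZero ∣ a - b ∣ x y

ifEq-≡ : ∀ a x y → ifEq a a x y ≡ x
ifEq-≡ a x y rewrite ∣n-n∣≡0 a = refl

ifEq-≢ : ∀ {a b} x y → a ≢ b → ifEq a b x y ≡ y
ifEq-≢ {a} {b} x y a≢b with ∣ a - b ∣ in eq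
... | zero = ⊥-elim (a≢b (∣m-n∣≡0⇒m≡n eq))
... | suc _ = refl

ifEqᶜ : ∀ {n} → Code n → Code n → Code n → Code n → Code n
ifEqᶜ f g s t = ifZeroᶜ ∘ᶜ (distᶜ f g ∷ s ∷ t ∷ [])

ifEqᶜ-eval : ∀ {n} {f g s t : Code n} {xs a b x y} →
             Ev f xs a → Ev g xs b → Ev s xs x → Ev t xs y → Ev (ifEqᶜ f g s t) xs (ifEq a b x y)
ifEqᶜ-eval {a = a} {b} {x} {y} d e h k =
  eval-∘ (distᶜ-eval d e ∷ h ∷ k ∷ []) (ifZeroᶜ-eval ∣ a - b ∣ x y)

-- Cantor unpairing

tri-mono-≤ : ∀ {a b} → a ≤ b → tri a ≤ tri b
tri-mono-≤ z≤n = z≤n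
tri-mono-≤ (s≤s a≤b) = s≤s (+-mono-≤ a≤b (tri-mono-≤ a≤b))

n≤tri[n] : ∀ n → n ≤ tri n
n≤tri[n] zero = z≤n
n≤tri[n] (suc n) = m≤m+n (suc n) (tri n)

diagonal : ∀ x → ∃ λ d → tri d ≤ x × x < tri (suc d)
diagonal zero = 0 , z≤n , s≤s z≤n
diagonal (suc x) with diagonal x
... | d , lo , hi with suc x <? tri (suc d)
...   | yes x<next = d , m≤n⇒m≤1+n lo , x<next
...   | no x≮next = suc d , ≤-reflexive (sym x≡next) , x<after
  where
  x≡next : suc x ≡ tri (suc d)
  x≡next = ≤-antisym hi (≮⇒≥ x≮next)
  x<after : suc x < tri (suc (suc d))
  x<after = subst (_< suc (suc d) + tri (suc d)) (sym x≡next) (s≤s (m≤n+m _ (suc d)))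

diag : ℕ → ℕ
diag x = proj₁ (diagonal x)

tri[diag]≤ : ∀ x → tri (diag x) ≤ x
tri[diag]≤ x = proj₁ (proj₂ (diagonal x))

<tri[1+diag] : ∀ x → x < tri (suc (diag x))
<tri[1+diag] x = proj₂ (proj₂ (diagonal x))

diag-unique : ∀ {x d} → tri d ≤ x → x < tri (suc d) → diag x ≡ d
diag-unique {x} {d} lo hi with <-cmp (diag x) d
... | tri< δ<d _ _ = ⊥-elim (<⇒≱ (<tri[1+diag] x) (≤-trans (tri-mono-≤ δ<d) lo))
... | tri≈ _ δ≡d _ = δ≡d
... | tri> _ _ d<δ = ⊥-elim (<⇒≱ hi (≤-trans (tri-mono-≤ d<δ) (tri[diag]≤ x)))

unpair₂ : ℕ → ℕ
unpair₂ x = x ∸ tri (diag x)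

unpair₁ : ℕ → ℕ
unpair₁ x = diag x ∸ unpair₂ x

unpair₂≤ : ∀ x → unpair₂ x ≤ x
unpair₂≤ x = m∸n≤m x (tri (diag x))

unpair₂≤diag : ∀ x → unpair₂ x ≤ diag x
unpair₂≤diag x = s≤s⁻¹ (+-cancelʳ-≤ (tri (diag x)) _ _ bound)
  where
  bound : suc (unpair₂ x) + tri (diag x) ≤ suc (diag x) + tri (diag x)
  bound = subst (λ z → suc z ≤ suc (diag x) + tri (diag x))
                (sym (m∸n+n≡m (tri[diag]≤ x))) (<tri[1+diag] x)

diag-pair : ∀ a b → diag ⟪ a , b ⟫ ≡ a + b
diag-pair a b = diag-unique (m≤m+n (tri (a + b)) b) pair<
  where
  pair< : ⟪ a , b ⟫ < tri (suc (a + b))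
  pair< = subst (_< suc (a + b) + tri (a + b)) (+-comm b (tri (a + b)))
                (+-monoˡ-< (tri (a + b)) (s≤s (m≤n+m b a)))

unpair₂-pair : ∀ a b → unpair₂ ⟪ a , b ⟫ ≡ b
unpair₂-pair a b rewrite diag-pair a b = m+n∸m≡n (tri (a + b)) b

unpair₁-pair : ∀ a b → unpair₁ ⟪ a , b ⟫ ≡ a
unpair₁-pair a b rewrite unpair₂-pair a b | diag-pair a b = m+n∸n≡m a b

pair-unpair : ∀ x → ⟪ unpair₁ x , unpair₂ x ⟫ ≡ x
pair-unpair x = begin
  tri (unpair₁ x + unpair₂ x) + unpair₂ x
    ≡⟨ cong (λ d → tri d + unpair₂ x) (m∸n+n≡m (unpair₂≤diag x)) ⟩
  tri (diag x) + (x ∸ tri (diag x))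
    ≡⟨ m+[n∸m]≡n (tri[diag]≤ x) ⟩
  x ∎
  where open ≡-Reasoning

≤pair₁ : ∀ a b → a ≤ ⟪ a , b ⟫
≤pair₁ a b = ≤-trans (m≤m+n a b) (≤-trans (n≤tri[n] (a + b)) (m≤m+n (tri (a + b)) b))

≤pair₂ : ∀ a b → b ≤ ⟪ a , b ⟫
≤pair₂ a b = m≤n+m b (tri (a + b))

triᶜ : Code 1
triᶜ = prec zeroC (sucᶜ arg₀ +ᶜ arg₁)

triᶜ-eval : ∀ k → Ev triᶜ (k ∷ []) (tri k)
triᶜ-eval zero = e-prec0 e-zero
triᶜ-eval (suc k) = e-precS (triᶜ-eval k) (+ᶜ-eval (sucᶜ-eval e-proj) e-proj)

-- the least z with x < tri (z + 1), i.e. the first zero of (x + 1) ∸ tri (z + 1)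
diagᶜ : Code 1
diagᶜ = mu (sucᶜ arg₁ ∸ᶜ triᶜ ∙ᶜ sucᶜ arg₀)

diagᶜ-eval : ∀ x → Ev diagᶜ (x ∷ []) (diag x)
diagᶜ-eval x =
  e-mu (subst (Ev _ _) (m≤n⇒m∸n≡0 (<tri[1+diag] x)) (body-eval (diag x))) below
  where
  body-eval : ∀ z → Ev (sucᶜ arg₁ ∸ᶜ triᶜ ∙ᶜ sucᶜ arg₀) (z ∷ x ∷ []) (suc x ∸ tri (suc z))
  body-eval z = ∸ᶜ-eval (sucᶜ-eval e-proj) (∙ᶜ-eval (sucᶜ-eval e-proj) (triᶜ-eval (suc z)))
  below : ∀ z → z < diag x → ∃ λ w → Ev _ (z ∷ x ∷ []) (suc w)
  below z z<δ = x ∸ tri (suc z) ,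
    subst (Ev _ _) (+-∸-assoc 1 (≤-trans (tri-mono-≤ z<δ) (tri[diag]≤ x))) (body-eval z)

unpair₂ᶜ : Code 1
unpair₂ᶜ = arg₀ ∸ᶜ triᶜ ∙ᶜ diagᶜ

unpair₂ᶜ-eval : ∀ x → Ev unpair₂ᶜ (x ∷ []) (unpair₂ x)
unpair₂ᶜ-eval x = ∸ᶜ-eval e-proj (∙ᶜ-eval (diagᶜ-eval x) (triᶜ-eval (diag x)))

unpair₁ᶜ : Code 1
unpair₁ᶜ = diagᶜ ∸ᶜ unpair₂ᶜ

unpair₁ᶜ-eval : ∀ x → Ev unpair₁ᶜ (x ∷ []) (unpair₁ x)
unpair₁ᶜ-eval x = ∸ᶜ-eval (diagᶜ-eval x) (unpair₂ᶜ-eval x)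

-- Finite permutations

transpose : ℕ → ℕ → ℕ → ℕ
transpose i j a = ifEq a i j (ifEq a j i a)

transpose-left : ∀ i j → transpose i j i ≡ j
transpose-left i j = ifEq-≡ i j _

transpose-right : ∀ i j → transpose i j j ≡ i
transpose-right i j with j ≟ i
... | yes refl = ifEq-≡ j j _
... | no j≢i = trans (ifEq-≢ j _ j≢i) (ifEq-≡ j i j)

transpose-other : ∀ {i j a} → a ≢ i → a ≢ j → transpose i j a ≡ a
transpose-other {i} {j} {a} a≢i a≢j = trans (ifEq-≢ j _ a≢i) (ifEq-≢ i a a≢j)

transpose-involutive : ∀ i j a → transpose i j (transpose i j a) ≡ a
transpose-involutive i j a with a ≟ i | a ≟ j
... | yes refl | _ = trans (cong (transpose a j) (transpose-left a j)) (transpose-right a j)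
... | no _ | yes refl = trans (cong (transpose i a) (transpose-right i a)) (transpose-left i a)
... | no a≢i | no a≢j = trans (cong (transpose i j) (transpose-other a≢i a≢j)) (transpose-other a≢i a≢j)

transpose-same : ∀ i a → transpose i i a ≡ a
transpose-same i a with a ≟ i
... | yes refl = transpose-left a a
... | no a≢i = transpose-other a≢i a≢i

-- A number s encodes a list of transpositions: 0 is the empty list and
-- suc ⟪ ⟪ i , j ⟫ , t ⟫ is (i j) followed by the list t.

transposition : ℕ → ℕ → ℕ
transposition h = transpose (unpair₁ h) (unpair₂ h)

transposition-involutive : ∀ h a → transposition h (transposition h a) ≡ a
transposition-involutive h = transpose-involutive (unpair₁ h) (unpair₂ h)

firstSwap otherSwaps : ℕ → ℕ
firstSwap s = unpair₁ (pred s)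
otherSwaps s = unpair₂ (pred s)

dropSwaps : ℕ → ℕ → ℕ
dropSwaps s zero = s
dropSwaps s (suc k) = otherSwaps (dropSwaps s k)

applySwaps : ℕ → ℕ → ℕ → ℕ
applySwaps s zero a = a
applySwaps s (suc k) a = transposition (firstSwap (dropSwaps s k)) (applySwaps s k a)

-- The list q has at most q entries, so q steps apply all of it.
finitePerm : ℕ → ℕ → ℕ
finitePerm q = applySwaps q q

dropSwaps-otherSwaps : ∀ s k → dropSwaps (otherSwaps s) k ≡ dropSwaps s (suc k)
dropSwaps-otherSwaps s zero = refl
dropSwaps-otherSwaps s (suc k) = cong otherSwaps (dropSwaps-otherSwaps s k)

applySwaps-uncons : ∀ s k a →
  applySwaps (otherSwaps s) k (transposition (firstSwap s) a) ≡ applySwaps s (suc k) a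
applySwaps-uncons s zero a = refl
applySwaps-uncons s (suc k) a =
  cong₂ (λ t b → transposition (firstSwap t) b) (dropSwaps-otherSwaps s k) (applySwaps-uncons s k a)

dropSwaps≤ : ∀ s k → dropSwaps s k ≤ s ∸ k
dropSwaps≤ s zero = ≤-refl
dropSwaps≤ s (suc k) = begin
  otherSwaps (dropSwaps s k) ≤⟨ unpair₂≤ (pred (dropSwaps s k)) ⟩
  pred (dropSwaps s k)       ≤⟨ pred-mono-≤ (dropSwaps≤ s k) ⟩
  pred (s ∸ k)               ≡⟨ pred[m∸n]≡m∸[1+n] s k ⟩
  s ∸ suc k                  ∎
  where open ≤-Reasoning

dropSwaps-exhausted : ∀ {s k} → s ≤ k → dropSwaps s k ≡ 0
dropSwaps-exhausted {s} {k} s≤k =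
  n≤0⇒n≡0 (≤-trans (dropSwaps≤ s k) (≤-reflexive (m≤n⇒m∸n≡0 s≤k)))

applySwaps-exhausted : ∀ {s k} a → s ≤ k → applySwaps s k a ≡ finitePerm s a
applySwaps-exhausted {s} {k} a s≤k =
  trans (cong (λ k → applySwaps s k a) (sym (m∸n+n≡m s≤k))) (beyond (k ∸ s))
  where
  beyond : ∀ d → applySwaps s (d + s) a ≡ applySwaps s s a
  beyond zero = refl
  beyond (suc d) rewrite dropSwaps-exhausted (m≤n+m s d) = trans (transpose-same 0 _) (beyond d)

transposition-pair : ∀ i j a → transposition ⟪ i , j ⟫ a ≡ transpose i j a
transposition-pair i j a = cong₂ (λ x y → transpose x y a) (unpair₁-pair i j) (unpair₂-pair i j)

finitePerm-cons : ∀ i j q a → finitePerm (suc ⟪ ⟪ i , j ⟫ , q ⟫) a ≡ finitePerm q (transpose i j a)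
finitePerm-cons i j q a = begin
  applySwaps s (suc ⟪ h , q ⟫) a
    ≡⟨ applySwaps-uncons s ⟪ h , q ⟫ a ⟨
  applySwaps (otherSwaps s) ⟪ h , q ⟫ (transposition (firstSwap s) a)
    ≡⟨ cong₂ (λ t g → applySwaps t ⟪ h , q ⟫ (transposition g a))
             (unpair₂-pair h q) (unpair₁-pair h q) ⟩
  applySwaps q ⟪ h , q ⟫ (transposition h a)
    ≡⟨ applySwaps-exhausted _ (≤pair₂ h q) ⟩
  finitePerm q (transposition h a)
    ≡⟨ cong (finitePerm q) (transposition-pair i j a) ⟩
  finitePerm q (transpose i j a)
    ∎
  where
  open ≡-Reasoning
  h s : ℕ
  h = ⟪ i , j ⟫
  s = suc ⟪ h , q ⟫

applySwaps-injective : ∀ s k {a b} → applySwaps s k a ≡ applySwaps s k b → a ≡ b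
applySwaps-injective s zero eq = eq
applySwaps-injective s (suc k) {a} {b} eq = applySwaps-injective s k (begin
  applySwaps s k a                         ≡⟨ transposition-involutive h _ ⟨
  transposition h (applySwaps s (suc k) a) ≡⟨ cong (transposition h) eq ⟩
  transposition h (applySwaps s (suc k) b) ≡⟨ transposition-involutive h _ ⟩
  applySwaps s k b                         ∎)
  where
  open ≡-Reasoning
  h : ℕ
  h = firstSwap (dropSwaps s k)

applySwaps-surjective : ∀ s k b → ∃ λ a → applySwaps s k a ≡ b
applySwaps-surjective s zero b = b , refl
applySwaps-surjective s (suc k) b =
  let a , eq = applySwaps-surjective s k (transposition h b)
  in  a , trans (cong (transposition h) eq) (transposition-involutive h b)
  where
  h : ℕ
  h = firstSwap (dropSwaps s k)

finitePerm-extends : (f : ℕ → ℕ) → (∀ a b → f a ≡ f b → a ≡ b) →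
                     ∀ B → ∃ λ q → ∀ a → a < B → finitePerm q a ≡ f a
finitePerm-extends f f-inj zero = 0 , λ a ()
finitePerm-extends f f-inj (suc B) with finitePerm-extends f f-inj B
... | q , agrees with applySwaps-surjective q q (f B)
...   | d , q[d]≡fB = suc ⟪ ⟪ B , d ⟫ , q ⟫ , agrees′
  where
  agrees′ : ∀ a → a < suc B → finitePerm (suc ⟪ ⟪ B , d ⟫ , q ⟫) a ≡ f a
  agrees′ a a<1+B with a ≟ B
  ... | yes refl = trans (finitePerm-cons a d q a) (trans (cong (finitePerm q) (transpose-left a d)) q[d]≡fB)
  ... | no a≢B =
    trans (finitePerm-cons B d q a) (trans (cong (finitePerm q) (transpose-other a≢B a≢d)) (agrees a a<B))
    where
    a<B : a < B
    a<B = ≤∧≢⇒< (s≤s⁻¹ a<1+B) a≢B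
    a≢d : a ≢ d
    a≢d refl = a≢B (f-inj a B (trans (sym (agrees a a<B)) q[d]≡fB))

transpositionᶜ : Code 2
transpositionᶜ = ifEqᶜ arg₁ i j (ifEqᶜ arg₁ j i arg₁)
  where
  i j : Code 2
  i = unpair₁ᶜ ∙ᶜ arg₀
  j = unpair₂ᶜ ∙ᶜ arg₀

transpositionᶜ-eval : ∀ h a → Ev transpositionᶜ (h ∷ a ∷ []) (transposition h a)
transpositionᶜ-eval h a = ifEqᶜ-eval e-proj i j (ifEqᶜ-eval e-proj j i e-proj)
  where
  i : Ev (unpair₁ᶜ ∙ᶜ arg₀) (h ∷ a ∷ []) (unpair₁ h)
  i = ∙ᶜ-eval e-proj (unpair₁ᶜ-eval h)
  j : Ev (unpair₂ᶜ ∙ᶜ arg₀) (h ∷ a ∷ []) (unpair₂ h)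
  j = ∙ᶜ-eval e-proj (unpair₂ᶜ-eval h)

firstSwapᶜ otherSwapsᶜ : Code 1
firstSwapᶜ = unpair₁ᶜ ∙ᶜ predᶜ
otherSwapsᶜ = unpair₂ᶜ ∙ᶜ predᶜ

firstSwapᶜ-eval : ∀ s → Ev firstSwapᶜ (s ∷ []) (firstSwap s)
firstSwapᶜ-eval s = ∙ᶜ-eval (predᶜ-eval s) (unpair₁ᶜ-eval (pred s))

otherSwapsᶜ-eval : ∀ s → Ev otherSwapsᶜ (s ∷ []) (otherSwaps s)
otherSwapsᶜ-eval s = ∙ᶜ-eval (predᶜ-eval s) (unpair₂ᶜ-eval (pred s))

dropSwapsᶜ : Code 2
dropSwapsᶜ = prec arg₀ (otherSwapsᶜ ∙ᶜ arg₁)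

dropSwapsᶜ-eval : ∀ k s → Ev dropSwapsᶜ (k ∷ s ∷ []) (dropSwaps s k)
dropSwapsᶜ-eval zero s = e-prec0 e-proj
dropSwapsᶜ-eval (suc k) s = e-precS (dropSwapsᶜ-eval k s) (∙ᶜ-eval e-proj (otherSwapsᶜ-eval _))

applySwapsᶜ : Code 3
applySwapsᶜ = prec arg₁ (transpositionᶜ ∘ᶜ (firstSwapᶜ ∙ᶜ dropSwapsᶜ ∘ᶜ (arg₀ ∷ arg₂ ∷ []) ∷ arg₁ ∷ []))

applySwapsᶜ-eval : ∀ k s a → Ev applySwapsᶜ (k ∷ s ∷ a ∷ []) (applySwaps s k a)
applySwapsᶜ-eval zero s a = e-prec0 e-proj
applySwapsᶜ-eval (suc k) s a = e-precS (applySwapsᶜ-eval k s a)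
  (eval-∘ (first-eval ∷ e-proj ∷ []) (transpositionᶜ-eval _ (applySwaps s k a)))
  where
  first-eval : Ev (firstSwapᶜ ∙ᶜ dropSwapsᶜ ∘ᶜ (arg₀ ∷ arg₂ ∷ [])) (k ∷ applySwaps s k a ∷ s ∷ a ∷ [])
                  (firstSwap (dropSwaps s k))
  first-eval = ∙ᶜ-eval (eval-∘ (e-proj ∷ e-proj ∷ []) (dropSwapsᶜ-eval k s)) (firstSwapᶜ-eval _)

finitePermᶜ : Code 2
finitePermᶜ = applySwapsᶜ ∘ᶜ (arg₀ ∷ arg₀ ∷ arg₁ ∷ [])

finitePermᶜ-eval : ∀ q a → Ev finitePermᶜ (q ∷ a ∷ []) (finitePerm q a)
finitePermᶜ-eval q a = eval-∘ (e-proj ∷ e-proj ∷ e-proj ∷ []) (applySwapsᶜ-eval q q a)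

finitePermAt : ℕ → Code 1
finitePermAt q = finitePermᶜ ∘ᶜ (constᶜ q ∷ arg₀ ∷ [])

finitePermAt-eval : ∀ q n → finitePermAt q [ n ]≃ finitePerm q n
finitePermAt-eval q n = eval-∘ (constᶜ-eval q ∷ e-proj ∷ []) (finitePermᶜ-eval q n)

finitePermAt-value : ∀ {q n m} → finitePermAt q [ n ]≃ m → m ≡ finitePerm q n
finitePermAt-value d = eval-deterministic d (finitePermAt-eval _ _)

finitePermAt-isPermutation : ∀ q → IsPermutation (finitePermAt q)
finitePermAt-isPermutation q =
  (λ n → finitePerm q n , finitePermAt-eval q n) ,
  (λ n n′ m d d′ → applySwaps-injective q q (trans (sym (finitePermAt-value d)) (finitePermAt-value d′))) ,
  (λ m → let n , q[n]≡m = applySwaps-surjective q q m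
         in  n , subst (finitePermAt q [ n ]≃_) q[n]≡m (finitePermAt-eval q n))

Characterises : Code 2 → ℕ → (ℕ → Set) → Set
Characterises G q X = ∀ x → (X x × Ev G (q ∷ x ∷ []) 1) ⊎ (¬ X x × Ev G (q ∷ x ∷ []) 0)

graphᶜ : Code 2
graphᶜ = ifEqᶜ (finitePermᶜ ∘ᶜ (arg₀ ∷ unpair₁ᶜ ∙ᶜ arg₁ ∷ [])) (unpair₂ᶜ ∙ᶜ arg₁)
                (constᶜ 1) (constᶜ 0)

graphᶜ-eval : ∀ q x → Ev graphᶜ (q ∷ x ∷ []) (ifEq (finitePerm q (unpair₁ x)) (unpair₂ x) 1 0)
graphᶜ-eval q x =
  ifEqᶜ-eval (eval-∘ (e-proj ∷ ∙ᶜ-eval e-proj (unpair₁ᶜ-eval x) ∷ []) (finitePermᶜ-eval q _))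
             (∙ᶜ-eval e-proj (unpair₂ᶜ-eval x)) (constᶜ-eval 1) (constᶜ-eval 0)

graphᶜ-characterises : ∀ q → Characterises graphᶜ q (graph (finitePermAt q))
graphᶜ-characterises q x with finitePerm q (unpair₁ x) ≟ unpair₂ x
... | yes eq = inj₁ (in-graph , subst (Ev graphᶜ _) value≡1 (graphᶜ-eval q x))
  where
  in-graph : graph (finitePermAt q) x
  in-graph = unpair₁ x , unpair₂ x , sym (pair-unpair x) ,
             subst (finitePermAt q [ unpair₁ x ]≃_) eq (finitePermAt-eval q (unpair₁ x))
  value≡1 : ifEq (finitePerm q (unpair₁ x)) (unpair₂ x) 1 0 ≡ 1
  value≡1 rewrite eq = ifEq-≡ (unpair₂ x) 1 0
... | no neq = inj₂ (not-in-graph , subst (Ev graphᶜ _) (ifEq-≢ 1 0 neq) (graphᶜ-eval q x))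
  where
  not-in-graph : ¬ graph (finitePermAt q) x
  not-in-graph (n , m , refl , d) =
    neq (trans (cong (finitePerm q) (unpair₁-pair n m))
               (trans (sym (finitePermAt-value d)) (sym (unpair₂-pair n m))))

-- Relativisation

reindex : ∀ {m n} → Code m → (Fin m → Fin n) → Code n
reindex c ρ = comp c (λ i → proj (ρ i))

swap₀₁ : ∀ {n} → Fin (suc (suc n)) → Fin (suc (suc n))
swap₀₁ zero = suc zero
swap₀₁ (suc zero) = zero
swap₀₁ (suc (suc i)) = suc (suc i)

rotate₀₁₂ : ∀ {n} → Fin (suc (suc (suc n))) → Fin (suc (suc (suc n)))
rotate₀₁₂ zero = suc (suc zero)
rotate₀₁₂ (suc zero) = zero
rotate₀₁₂ (suc (suc zero)) = suc zero
rotate₀₁₂ (suc (suc (suc i))) = suc (suc (suc i))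

-- The oracle becomes G, and every code takes an extra first argument q that is passed on to G.
-- Since prec and mu need their counter in front, their arguments are reordered around q.
relativise : Code 2 → ∀ {n} → Code n → Code (suc n)
relativise G zeroC = zeroC
relativise G sucC = sucᶜ arg₁
relativise G (proj i) = proj (suc i)
relativise G (comp f gs) = comp (relativise G f) λ { zero → arg₀ ; (suc i) → relativise G (gs i) }
relativise G (prec g h) = reindex (prec (relativise G g) (reindex (relativise G h) rotate₀₁₂)) swap₀₁
relativise G (mu f) = mu (reindex (relativise G f) swap₀₁)
relativise G orc = G

tabulate-swap₀₁ : ∀ {n} a b (xs : Vec ℕ n) →
                  tabulate (λ i → lookup (a ∷ b ∷ xs) (swap₀₁ i)) ≡ b ∷ a ∷ xs
tabulate-swap₀₁ a b xs = cong (λ zs → b ∷ a ∷ zs) (tabulate∘lookup xs)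

tabulate-rotate₀₁₂ : ∀ {n} a b c (xs : Vec ℕ n) →
                     tabulate (λ i → lookup (a ∷ b ∷ c ∷ xs) (rotate₀₁₂ i)) ≡ c ∷ a ∷ b ∷ xs
tabulate-rotate₀₁₂ a b c xs = cong (λ zs → c ∷ a ∷ b ∷ zs) (tabulate∘lookup xs)

reindex-eval : ∀ {X m n} {c : Code m} {ρ : Fin m → Fin n} {xs ws v} →
               tabulate (λ i → lookup xs (ρ i)) ≡ ws → Eval X c ws v → Eval X (reindex c ρ) xs v
reindex-eval {X} {c = c} {ρ} {xs} {v = v} eq d =
  e-comp (λ i → lookup xs (ρ i)) (λ i → e-proj) (subst (λ zs → Eval X c zs v) (sym eq) d)

reindex-args : ∀ {X m n} {ρ : Fin m → Fin n} {xs : Vec ℕ n} {ys : Fin m → ℕ} →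
               (∀ i → Eval X (proj (ρ i)) xs (ys i)) → tabulate ys ≡ tabulate (λ i → lookup xs (ρ i))
reindex-args ds = tabulate-cong (λ i → eval-deterministic (ds i) e-proj)

module Relativise (G : Code 2) (q : ℕ) (X : ℕ → Set) (G-char : Characterises G q X) where

  relativise-sound : ∀ {n} {c : Code n} {xs v} → Eval X c xs v → Ev (relativise G c) (q ∷ xs) v
  relativise-sound-prec : ∀ {n} {g : Code n} {h y xs v} → Eval X (prec g h) (y ∷ xs) v →
    Ev (prec (relativise G g) (reindex (relativise G h) rotate₀₁₂)) (y ∷ q ∷ xs) v

  relativise-sound e-zero = e-zero
  relativise-sound e-suc = sucᶜ-eval e-proj
  relativise-sound e-proj = e-proj
  relativise-sound (e-comp ys ds d) =
    e-comp (λ { zero → q ; (suc i) → ys i })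
           (λ { zero → e-proj ; (suc i) → relativise-sound (ds i) })
           (relativise-sound d)
  relativise-sound (e-prec0 {xs = xs} d) =
    reindex-eval (tabulate-swap₀₁ q 0 xs) (relativise-sound-prec (e-prec0 d))
  relativise-sound (e-precS {y = y} {xs = xs} d e) =
    reindex-eval (tabulate-swap₀₁ q (suc y) xs) (relativise-sound-prec (e-precS d e))
  relativise-sound (e-mu {xs = xs} d below) =
    e-mu (reindex-eval (tabulate-swap₀₁ _ q xs) (relativise-sound d))
         (λ z z<y → proj₁ (below z z<y) ,
                    reindex-eval (tabulate-swap₀₁ z q xs) (relativise-sound (proj₂ (below z z<y))))
  relativise-sound (e-orc-yes {x} x∈X) with G-char x
  ... | inj₁ (_ , d) = d
  ... | inj₂ (x∉X , _) = ⊥-elim (x∉X x∈X)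
  relativise-sound (e-orc-no {x} x∉X) with G-char x
  ... | inj₁ (x∈X , _) = ⊥-elim (x∉X x∈X)
  ... | inj₂ (_ , d) = d

  relativise-sound-prec (e-prec0 d) = e-prec0 (relativise-sound d)
  relativise-sound-prec (e-precS {y = y} {xs = xs} {w = w} d e) =
    e-precS (relativise-sound-prec d) (reindex-eval (tabulate-rotate₀₁₂ y w q xs) (relativise-sound e))

  -- The argument vector is abstracted as ws with ws ≡ q ∷ xs so that the
  -- evaluation derivation can be matched on.
  relativise-complete : ∀ {n} (c : Code n) {ws xs v} → ws ≡ q ∷ xs →
                        Ev (relativise G c) ws v → Eval X c xs v
  relativise-complete-prec : ∀ {n} (g : Code n) (h : Code (suc (suc n))) {ws y xs v} → ws ≡ y ∷ q ∷ xs →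
    Ev (prec (relativise G g) (reindex (relativise G h) rotate₀₁₂)) ws v → Eval X (prec g h) (y ∷ xs) v
  relativise-complete-swap₀₁ : ∀ {n} (f : Code (suc n)) {z xs v} →
    Ev (reindex (relativise G f) swap₀₁) (z ∷ q ∷ xs) v → Eval X f (z ∷ xs) v
  relativise-complete-rotate₀₁₂ : ∀ {n} (h : Code (suc (suc n))) {y w xs v} →
    Ev (reindex (relativise G h) rotate₀₁₂) (y ∷ w ∷ q ∷ xs) v → Eval X h (y ∷ w ∷ xs) v

  relativise-complete zeroC refl e-zero = e-zero
  relativise-complete sucC {xs = x ∷ []} refl (e-comp ys ds e-suc)
    rewrite eval-deterministic (ds zero) e-proj = e-suc
  relativise-complete (proj i) refl e-proj = e-proj
  relativise-complete (comp f gs) refl (e-comp ys ds d) =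
    e-comp (λ i → ys (suc i)) (λ i → relativise-complete (gs i) refl (ds (suc i)))
           (relativise-complete f (cong (λ z → z ∷ tabulate (λ i → ys (suc i)))
                                        (eval-deterministic (ds zero) e-proj)) d)
  relativise-complete (prec g h) {xs = y ∷ xs} refl (e-comp ys ds d) =
    relativise-complete-prec g h (trans (reindex-args ds) (tabulate-swap₀₁ q y xs)) d
  relativise-complete (mu f) refl (e-mu d below) =
    e-mu (relativise-complete-swap₀₁ f d)
         (λ z z<y → proj₁ (below z z<y) , relativise-complete-swap₀₁ f (proj₂ (below z z<y)))
  relativise-complete orc {xs = x ∷ []} refl d with G-char x
  ... | inj₁ (x∈X , d′) = subst (Eval X orc _) (eval-deterministic d′ d) (e-orc-yes x∈X)
  ... | inj₂ (x∉X , d′) = subst (Eval X orc _) (eval-deterministic d′ d) (e-orc-no x∉X)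

  relativise-complete-prec g h refl (e-prec0 d) = e-prec0 (relativise-complete g refl d)
  relativise-complete-prec g h refl (e-precS d e) =
    e-precS (relativise-complete-prec g h refl d) (relativise-complete-rotate₀₁₂ h e)

  relativise-complete-swap₀₁ f {z} {xs} (e-comp ys ds d) =
    relativise-complete f (trans (reindex-args ds) (tabulate-swap₀₁ z q xs)) d
  relativise-complete-rotate₀₁₂ h {y} {w} {xs} (e-comp ys ds d) =
    relativise-complete h (trans (reindex-args ds) (tabulate-rotate₀₁₂ y w q xs)) d

-- The use principle

Agree : (ℕ → Set) → (ℕ → Set) → ℕ → Set
Agree X Y B = ∀ x → x < B → (X x → Y x) × (Y x → X x)

Agree-≤ : ∀ {X Y B B′} → B ≤ B′ → Agree X Y B′ → Agree X Y B
Agree-≤ B≤B′ agree x x<B = agree x (<-≤-trans x<B B≤B′)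

HoldsNear : (ℕ → Set) → ((ℕ → Set) → Set) → Set₁
HoldsNear X P = ∃ λ B → ∀ Y → Agree X Y B → P Y

module _ {X : ℕ → Set} where

  holdsNear-× : ∀ {P Q} → HoldsNear X P → HoldsNear X Q → HoldsNear X (λ Y → P Y × Q Y)
  holdsNear-× (B₁ , p) (B₂ , q) =
    B₁ ⊔ B₂ , λ Y agree → p Y (Agree-≤ (m≤m⊔n B₁ B₂) agree) ,
                          q Y (Agree-≤ (m≤n⊔m B₁ B₂) agree)

  holdsNear-Fin : ∀ m {P : Fin m → (ℕ → Set) → Set} →
                  (∀ i → HoldsNear X (P i)) → HoldsNear X (λ Y → ∀ i → P i Y)
  holdsNear-Fin zero ps = 0 , λ Y agree ()
  holdsNear-Fin (suc m) ps with holdsNear-× (ps zero) (holdsNear-Fin m (λ i → ps (suc i)))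
  ... | B , p = B , λ Y agree → λ { zero → proj₁ (p Y agree) ; (suc i) → proj₂ (p Y agree) i }

  holdsNear-< : ∀ y {P : (z : ℕ) → z < y → (ℕ → Set) → Set} → (∀ z z<y → HoldsNear X (P z z<y)) →
                HoldsNear X (λ Y → ∀ z z<y → P z z<y Y)
  holdsNear-< zero ps = 0 , λ Y agree z ()
  holdsNear-< (suc y) {P} ps
    with holdsNear-× (ps y (n<1+n y)) (holdsNear-< y (λ z z<y → ps z (m<n⇒m<1+n z<y)))
  ... | B , p = B , below
    where
    below : ∀ Y → Agree X Y B → ∀ z z<1+y → P z z<1+y Y
    below Y agree z z<1+y with z ≟ y
    ... | yes refl = subst (λ r → P z r Y) (<-irrelevant _ z<1+y) (proj₁ (p Y agree))
    ... | no z≢y =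
      subst (λ r → P z r Y) (<-irrelevant _ z<1+y) (proj₂ (p Y agree) z (≤∧≢⇒< (s≤s⁻¹ z<1+y) z≢y))

  use-principle : ∀ {n} {c : Code n} {xs v} → Eval X c xs v → HoldsNear X (λ Y → Eval Y c xs v)
  use-principle e-zero = 0 , λ Y agree → e-zero
  use-principle e-suc = 0 , λ Y agree → e-suc
  use-principle e-proj = 0 , λ Y agree → e-proj
  use-principle (e-comp {m = m} ys ds d)
    with holdsNear-× (holdsNear-Fin m (λ i → use-principle (ds i))) (use-principle d)
  ... | B , p = B , λ Y agree → e-comp ys (proj₁ (p Y agree)) (proj₂ (p Y agree))
  use-principle (e-prec0 d) with use-principle d
  ... | B , p = B , λ Y agree → e-prec0 (p Y agree)
  use-principle (e-precS d e) with holdsNear-× (use-principle d) (use-principle e)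
  ... | B , p = B , λ Y agree → e-precS (proj₁ (p Y agree)) (proj₂ (p Y agree))
  use-principle (e-mu {y = y} d below)
    with holdsNear-× (use-principle d) (holdsNear-< y (λ z z<y → use-principle (proj₂ (below z z<y))))
  ... | B , p =
    B , λ Y agree → e-mu (proj₁ (p Y agree)) (λ z z<y → proj₁ (below z z<y) , proj₂ (p Y agree) z z<y)
  use-principle (e-orc-yes {x} x∈X) = suc x , λ Y agree → e-orc-yes (proj₁ (agree x ≤-refl) x∈X)
  use-principle (e-orc-no {x} x∉X) = suc x , λ Y agree → e-orc-no (λ x∈Y → x∉X (proj₂ (agree x ≤-refl) x∈Y))

graphs-agree : ∀ {e e′ B} → (∀ n m → n < B → e [ n ]≃ m → e′ [ n ]≃ m) →
               (∀ n m → n < B → e′ [ n ]≃ m → e [ n ]≃ m) → Agree (graph e) (graph e′) B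
graphs-agree {B = B} e⊆e′ e′⊆e x x<B = ⊆-below e⊆e′ , ⊆-below e′⊆e
  where
  ⊆-below : ∀ {e e′} → (∀ n m → n < B → e [ n ]≃ m → e′ [ n ]≃ m) → graph e x → graph e′ x
  ⊆-below transfer (n , m , refl , d) = n , m , refl , transfer n m (≤-<-trans (≤pair₁ n m) x<B) d

-- Densities

count-disjoint : ∀ {S T : ℕ → Set} {N k k′} → AtLeast S N k → AtLeast T N k′ →
                 (∀ y → S y → ¬ T y) → k + k′ ≤ N
count-disjoint {S} {T} {N} {k} {k′} (f , f-inj , f-in) (g , g-inj , g-in) disjoint =
  injective⇒≤ {f = embed} embed-inj
  where
  value : Fin k ⊎ Fin k′ → ℕ
  value (inj₁ i) = f i
  value (inj₂ j) = g j
  value< : ∀ s → value s < N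
  value< (inj₁ i) = proj₁ (f-in i)
  value< (inj₂ j) = proj₁ (g-in j)
  value-inj : ∀ s t → value s ≡ value t → s ≡ t
  value-inj (inj₁ i) (inj₁ i′) eq = cong inj₁ (f-inj i i′ eq)
  value-inj (inj₁ i) (inj₂ j) eq = ⊥-elim (disjoint (g j) (subst S eq (proj₂ (f-in i))) (proj₂ (g-in j)))
  value-inj (inj₂ j) (inj₁ i) eq = ⊥-elim (disjoint (f i) (proj₂ (f-in i)) (subst T eq (proj₂ (g-in j))))
  value-inj (inj₂ j) (inj₂ j′) eq = cong inj₂ (g-inj j j′ eq)
  embed : Fin (k + k′) → Fin N
  embed i = fromℕ< (value< (splitAt k i))
  embed-inj : ∀ {i j} → embed i ≡ embed j → i ≡ j
  embed-inj {i} {j} eq = begin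
    i                        ≡⟨ join-splitAt k k′ i ⟨
    join k k′ (splitAt k i)  ≡⟨ cong (join k k′) (value-inj (splitAt k i) (splitAt k j) value-eq) ⟩
    join k k′ (splitAt k j)  ≡⟨ join-splitAt k k′ j ⟩
    j                        ∎
    where
    open ≡-Reasoning
    value-eq : value (splitAt k i) ≡ value (splitAt k j)
    value-eq = trans (sym (toℕ-fromℕ< (value< (splitAt k i))))
                     (trans (cong toℕ eq) (toℕ-fromℕ< (value< (splitAt k j))))

-- ρₙ(S) + ρₙ(T) ≤ 1 for disjoint S and T, and ρₙ(T) ≥ m/(m+1) eventually, so ρₙ(S) ≤ 1/(m+1) eventually.
disjoint⇒upperDensityZero : ∀ {S T : ℕ → Set} →
                            LowerDensityOne T → (∀ y → S y → ¬ T y) → UpperDensityZero S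
disjoint⇒upperDensityZero {S} {T} dense disjoint m =
  let N₀ , large = dense m in N₀ , sparse N₀ large
  where
  sparse : ∀ N₀ → (∀ N → N₀ ≤ N → ∃ λ k′ → AtLeast T N k′ × m * N ≤ k′ * suc m) →
           ∀ N → N₀ ≤ N → ∀ k → AtLeast S N k → k * suc m ≤ N
  sparse N₀ large N N₀≤N k S-count =
    let k′ , T-count , m*N≤k′*[1+m] = large N N₀≤N
        k+k′≤N = count-disjoint S-count T-count disjoint
    in  +-cancelʳ-≤ (k′ * suc m) (k * suc m) N (begin
          k * suc m + k′ * suc m ≡⟨ *-distribʳ-+ (suc m) k k′ ⟨
          (k + k′) * suc m       ≤⟨ *-monoˡ-≤ (suc m) k+k′≤N ⟩
          N * suc m              ≡⟨ *-suc N m ⟩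
          N + N * m              ≡⟨ cong (N +_) (*-comm N m) ⟩
          N + m * N              ≤⟨ +-monoʳ-≤ N m*N≤k′*[1+m] ⟩
          N + k′ * suc m         ∎)
    where open ≤-Reasoning

least-witness : ∀ {P : ℕ → Set} → Decidable P →
                ∀ {n} → P n → ∃ λ q → P q × (∀ z → z < q → ¬ P z)
least-witness {P} P? {n} Pn with least-below (suc n)
  where
  least-below : ∀ k → (∃ λ q → P q × (∀ z → z < q → ¬ P z)) ⊎ (∀ z → z < k → ¬ P z)
  least-below zero = inj₂ (λ z ())
  least-below (suc k) with least-below k
  ... | inj₁ least = inj₁ least
  ... | inj₂ none with P? k
  ...   | yes Pk = inj₁ (k , Pk , none)
  ...   | no ¬Pk = inj₂ (λ z z<1+k → [ none z , (λ { refl → ¬Pk }) ]′ (m<1+n⇒m<n∨m≡n z<1+k))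
... | inj₁ least = least
... | inj₂ none = ⊥-elim (none n ≤-refl Pn)

description-value : ∀ {A : ℕ → Bool} {Φ e X n m v} →
                    (∀ n n′ m → e [ n ]≃ m → e [ n′ ]≃ m → n ≡ n′) →
                    EffDenseDescription Φ X (image e (λ n → A n ≡ true)) →
                    e [ n ]≃ m → Φ ⟨ X ⟩[ m ]≃ v → v ≤ 1 → v ≡ bit (A n)
description-value {A} {n = n} e-inj (_ , says-in , says-out , _) e[n]≃m Φ≃v v≤1 with A n in An | v≤1
... | false | z≤n = refl
... | true | z≤n = ⊥-elim (says-out _ Φ≃v (n , An , e[n]≃m))
... | b | s≤s z≤n with says-in _ Φ≃v
...   | x , Ax , e[x]≃m with e-inj x n _ e[x]≃m e[n]≃m
...     | refl = trans (cong bit (sym Ax)) (cong bit An)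

module Main (A : ℕ → Bool) (Φ : Code 1)
            (describes : ∀ e → IsPermutation e → EffDenseDescription Φ (graph e) (image e (λ n → A n ≡ true)))
            where

  module Relativise-finitePerm q = Relativise graphᶜ q (graph (finitePermAt q)) (graphᶜ-characterises q)

  Hᶜ : Code 2
  Hᶜ = relativise graphᶜ Φ ∘ᶜ (arg₀ ∷ finitePermᶜ ∷ [])

  Hᶜ-eval : ∀ {q n v} → Φ ⟨ graph (finitePermAt q) ⟩[ finitePerm q n ]≃ v → Ev Hᶜ (q ∷ n ∷ []) v
  Hᶜ-eval {q} {n} d =
    eval-∘ (e-proj ∷ finitePermᶜ-eval q n ∷ []) (Relativise-finitePerm.relativise-sound q d)

  Hᶜ-eval⁻¹ : ∀ {q n v} → Ev Hᶜ (q ∷ n ∷ []) v → Φ ⟨ graph (finitePermAt q) ⟩[ finitePerm q n ]≃ v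
  Hᶜ-eval⁻¹ {q} {n} d with eval-∘⁻¹ d
  ... | _ , args , d′ with evalAll-deterministic args (e-proj ∷ finitePermᶜ-eval q n ∷ [])
  ...   | refl = Relativise-finitePerm.relativise-complete q Φ refl d′

  Hᶜ-total : ∀ q n → ∃ λ v → Ev Hᶜ (q ∷ n ∷ []) v
  Hᶜ-total q n = let v , d , _ = proj₁ (describes _ (finitePermAt-isPermutation q)) (finitePerm q n)
                 in  v , Hᶜ-eval d

  H : ℕ → ℕ → ℕ
  H q n = proj₁ (Hᶜ-total q n)

  -- φ(n) = H(q, n) for the least q with H(q, n) ≤ 1
  searchᶜ : Code 1
  searchᶜ = mu (Hᶜ ∸ᶜ constᶜ 1)

  φᶜ : Code 1
  φᶜ = Hᶜ ∘ᶜ (searchᶜ ∷ arg₀ ∷ [])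

  φᶜ-defined : ∀ {n q v} → Ev Hᶜ (q ∷ n ∷ []) v → v ≤ 1 → ∃ λ w → φᶜ [ n ]≃ w
  φᶜ-defined {n} {q₀} d v≤1 =
    let q , decided , undecided = least-witness (λ q → H q n ∸ 1 ≟ 0) decided₀
        search-eval = e-mu (subst (Ev _ _) decided (test-eval q)) (test-eval-below undecided)
    in  H q n , eval-∘ (search-eval ∷ e-proj ∷ []) (proj₂ (Hᶜ-total q n))
    where
    test-eval : ∀ q → Ev (Hᶜ ∸ᶜ constᶜ 1) (q ∷ n ∷ []) (H q n ∸ 1)
    test-eval q = ∸ᶜ-eval (proj₂ (Hᶜ-total q n)) (constᶜ-eval 1)
    decided₀ : H q₀ n ∸ 1 ≡ 0
    decided₀ = m≤n⇒m∸n≡0 (subst (_≤ 1) (eval-deterministic d (proj₂ (Hᶜ-total q₀ n))) v≤1)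
    test-eval-below : ∀ {q} → (∀ z → z < q → H z n ∸ 1 ≢ 0) →
                      ∀ z → z < q → ∃ λ w → Ev (Hᶜ ∸ᶜ constᶜ 1) (z ∷ n ∷ []) (suc w)
    test-eval-below undecided z z<q =
      pred (H z n ∸ 1) ,
      subst (Ev _ _) (sym (suc-pred _ {{≢-nonZero (undecided z z<q)}})) (test-eval z)

  φᶜ-correct : ∀ n v → φᶜ [ n ]≃ v → v ≡ bit (A n)
  φᶜ-correct n v d with eval-∘⁻¹ {gs = searchᶜ ∷ arg₀ ∷ []} d
  ... | q ∷ _ ∷ [] , e-mu decided _ ∷ e-proj ∷ [] , dH =
    let _ , injective , _ = finitePermAt-isPermutation q
    in  description-value injective (describes _ (finitePermAt-isPermutation q))
                          (finitePermAt-eval q n) (Hᶜ-eval⁻¹ dH)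
                          (m∸n≡0⇒m≤n (eval-deterministic (∸ᶜ-eval dH (constᶜ-eval 1)) decided))

  -- A computation of Φ relative to graph π queries only finitely much of π, which a finite
  -- permutation can copy; so some q reproduces it, and the search for q succeeds.
  φᶜ-defined-where-Φ-decides : ∀ {π x y v} → IsPermutation π → π [ x ]≃ y →
                               Φ ⟨ graph π ⟩[ y ]≃ v → v ≤ 1 → ∃ λ w → φᶜ [ x ]≃ w
  φᶜ-defined-where-Φ-decides {π} {x} {y} {v} (total , injective , _) π[x]≃y Φ≃v v≤1 =
    let B , near = use-principle Φ≃v
        q , copies = finitePerm-extends f f-injective (B ⊔ suc x)
        y≡q[x] = trans (eval-deterministic π[x]≃y (proj₂ (total x))) (sym (copies x (m≤n⊔m B (suc x))))
        agree = Agree-≤ (m≤m⊔n B (suc x)) (graphs-agree (π⊆q copies) (q⊆π copies))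
        Φ≃v-at-q = subst (λ z → Φ ⟨ graph (finitePermAt q) ⟩[ z ]≃ v) y≡q[x] (near _ agree)
    in  φᶜ-defined (Hᶜ-eval Φ≃v-at-q) v≤1
    where
    f : ℕ → ℕ
    f a = proj₁ (total a)
    f-injective : ∀ a b → f a ≡ f b → a ≡ b
    f-injective a b fa≡fb =
      injective a b (f b) (subst (π [ a ]≃_) fa≡fb (proj₂ (total a))) (proj₂ (total b))
    module _ {q B} (copies : ∀ a → a < B → finitePerm q a ≡ f a) where
      π⊆q : ∀ a m → a < B → π [ a ]≃ m → finitePermAt q [ a ]≃ m
      π⊆q a m a<B d = subst (finitePermAt q [ a ]≃_)
        (trans (copies a a<B) (eval-deterministic (proj₂ (total a)) d)) (finitePermAt-eval q a)
      q⊆π : ∀ a m → a < B → finitePermAt q [ a ]≃ m → π [ a ]≃ m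
      q⊆π a m a<B d = subst (π [ a ]≃_)
        (trans (sym (copies a a<B)) (sym (finitePermAt-value d))) (proj₂ (total a))

  φᶜ-undefined-small : IntrinsicallySmall (λ n → ¬ ∃ λ v → φᶜ [ n ]≃ v)
  φᶜ-undefined-small π π-perm =
    disjoint⇒upperDensityZero (proj₂ (proj₂ (proj₂ (describes π π-perm)))) undefined⇒undecided
    where
    undefined⇒undecided : ∀ y → image π (λ n → ¬ ∃ λ v → φᶜ [ n ]≃ v) y →
                          ¬ (Φ ⟨ graph π ⟩[ y ]≃ 0 ⊎ Φ ⟨ graph π ⟩[ y ]≃ 1)
    undefined⇒undecided y (x , undefined , π[x]≃y) = undefined ∘
      [ (λ Φ≃0 → φᶜ-defined-where-Φ-decides π-perm π[x]≃y Φ≃0 z≤n)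
      , (λ Φ≃1 → φᶜ-defined-where-Φ-decides π-perm π[x]≃y Φ≃1 (s≤s z≤n)) ]′

corollary5p8 : (A : ℕ → Bool) → OracleEffDenselyComputable A → IntrinsicallyGenericallyComputable A
corollary5p8 A (Φ , describes) = φᶜ , φᶜ-correct , φᶜ-undefined-small
  where open Main A Φ describes
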